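{- Let $D$ be a strongly connected oriented graph. Then the following two conditions are equivalent: (1) for every vertex $x$, the out-neighbourhood $x^+$ induces a tournament and the in-neighbourhood $x^-$ induces an acyclic digraph; (2) there exists a cyclic order of the vertices of $D$ such that for every arc $xy\in A(D)$ and every vertex $z\in\, ]x,y[$, we have $zy\in A(D)$.
   Context: An oriented graph is a digraph with no loops, no parallel arcs and no pair of opposite arcs. $x^+$ and $x^-$ denote the sets of out-neighbours and in-neighbours of $x$. A cyclic order of $V(D)$ is an ordering $v_1,\dots,v_n$ considered up to cyclic rotation. For vertices $v_i\neq v_j$, the open cyclic interval $]v_i,v_j[$ is the set of vertices strictly between $v_i$ and $v_j$ when going forward cyclically from $v_i$ to $v_j$, i.e. $\{v_k: i<k<j\}$ if $i<j$ and $\{v_k: k>i \text{ or } k<j\}$ if $i>j$. -}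

module Defs where

open import Data.Nat using (ℕ)
open import Data.Fin using (Fin; _<_)
open import Data.Bool using (Bool; true)
open import Data.Product using (_×_; Σ)
open import Data.Sum using (_⊎_)
open import Relation.Nullary using (¬_)
open import Relation.Binary.PropositionalEquality using (_≡_)
open import Relation.Binary.Construct.Closure.ReflexiveTransitive using (Star)
open import Relation.Binary.Construct.Closure.Transitive using (TransClosure)
open import Function.Bundles using (_↔_; Inverse)

Digraph : ℕ → Set
Digraph n = Fin n → Fin n → Bool

Arc : ∀ {n} → Digraph n → Fin n → Fin n → Set
Arc D x y = D x y ≡ true

IsOriented : ∀ {n} → Digraph n → Set
IsOriented {n} D = (∀ (x : Fin n) → ¬ Arc D x x)
                 × (∀ (x y : Fin n) → Arc D x y → ¬ Arc D y x)

IsStronglyConnected : ∀ {n} → Digraph n → Set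
IsStronglyConnected {n} D = ∀ (x y : Fin n) → Star (Arc D) x y

OutNbr : ∀ {n} → Digraph n → Fin n → Fin n → Set
OutNbr D x u = Arc D x u

InNbr : ∀ {n} → Digraph n → Fin n → Fin n → Set
InNbr D x u = Arc D u x

InducesTournament : ∀ {n} → Digraph n → (Fin n → Set) → Set
InducesTournament {n} D S =
  ∀ (u v : Fin n) → S u → S v → ¬ u ≡ v → Arc D u v ⊎ Arc D v u

InducedArc : ∀ {n} → Digraph n → (Fin n → Set) → Fin n → Fin n → Set
InducedArc D S u v = S u × S v × Arc D u v

InducesAcyclic : ∀ {n} → Digraph n → (Fin n → Set) → Set
InducesAcyclic {n} D S = ∀ (v : Fin n) → ¬ TransClosure (InducedArc D S) v v

-- A cyclic order of the vertices: a bijection between vertices and positions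
-- 0..n-1 (Inverse.to gives the position of a vertex); rotations are irrelevant
-- because the interval condition below is rotation invariant.
CyclicOrder : ℕ → Set
CyclicOrder n = Fin n ↔ Fin n

InOpenInterval : ∀ {n} → CyclicOrder n → Fin n → Fin n → Fin n → Set
InOpenInterval σ x y z =
  (i < k × k < j) ⊎ (j < i × (i < k ⊎ k < j))
  where
    open Inverse σ
    i = to x
    j = to y
    k = to z

Condition1 : ∀ {n} → Digraph n → Set
Condition1 {n} D = ∀ (x : Fin n) →
  InducesTournament D (OutNbr D x) × InducesAcyclic D (InNbr D x)

Condition2 : ∀ {n} → Digraph n → Set
Condition2 {n} D = Σ (CyclicOrder n) λ σ →
  ∀ (x y z : Fin n) → Arc D x y → InOpenInterval σ x y z → Arc D z y

-- (2) ⇒ (1): of two out-neighbours of x, the one met first when going around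
-- from x dominates the other; and an arc u → v inside x⁻ cannot jump over x, so
-- the position counted from just after x strictly increases along x⁻.
--
-- (1) ⇒ (2): first, every x⁺ is acyclic. An infinite walk in x⁺ together with a
-- walk of minimal length k from it back to x leads, via the tournament x⁺ and
-- acyclic in-neighbourhoods, either to a shorter such walk or to an infinite
-- walk inside p⁻ for the second vertex p of the walk. Hence x⁺ is a transitive
-- tournament with a first vertex next x, which dominates the rest of x⁺. If
-- x → t then t lies on the orbit of x under next (otherwise the orbit would walk
-- forever inside t⁻), so by strong connectivity next is one cyclic permutation;
-- listing its orbit gives the cyclic order, and following the orbit from x to y
-- keeps every visited vertex in y⁻.
module Submission where

open import Defs
open import Data.Bool using (true)
import Data.Bool.Properties as Bool
open import Data.Empty using (⊥; ⊥-elim)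
open import Data.Fin as Fin using (Fin; zero; suc; toℕ; fromℕ<)
open import Data.Fin.Properties using (any?; pigeonhole; toℕ<n; toℕ-fromℕ<; toℕ-injective)
import Data.Fin.Properties as Finₚ
open import Data.Nat as ℕ using (ℕ; zero; suc; _+_; _∸_; _≤_; _<_; s≤s; z<s; s≤s⁻¹)
open import Data.Nat.GeneralisedArithmetic using (fold; fold-+)
open import Data.Nat.Induction using (<-rec)
open import Data.Nat.Properties
open import Data.Product using (_×_; _,_; proj₁; proj₂; ∃; ∃-syntax; ∃₂)
open import Data.Sum using (_⊎_; inj₁; inj₂)
open import Function using (flip; _∘_)
open import Level using (0ℓ)
open import Function.Bundles using (Inverse; Injection; mk↔ₛ′)
open import Function.Properties.Inverse using (↔⇒↣)
open import Function.Construct.Identity using (↔-id)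
open import Relation.Binary using (Rel; Decidable; tri<; tri≈; tri>)
open import Relation.Binary.Construct.Closure.ReflexiveTransitive using (Star; ε; _◅_)
open import Relation.Binary.Construct.Closure.Transitive using (TransClosure; [_]; _∷_; _∷ʳ_)
open import Relation.Binary.PropositionalEquality
  using (_≡_; _≢_; refl; sym; trans; cong; subst; subst₂; module ≡-Reasoning)
open import Relation.Nullary using (¬_; yes; no; ¬?; _×-dec_)
open import Relation.Unary using (Pred)
  renaming (Decidable to Decidable₁)

Acyclic : {A : Set} → Rel A 0ℓ → Set
Acyclic R = ∀ v → ¬ TransClosure R v v

data Walk {A : Set} (R : Rel A 0ℓ) : ℕ → A → A → Set where
  [] : ∀ {x} → Walk R 0 x x
  _∷_ : ∀ {k x y z} → R x y → Walk R k y z → Walk R (suc k) x z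

module _ {A : Set} {R : Rel A 0ℓ} where

  star⇒walk : ∀ {x y} → Star R x y → ∃[ k ] Walk R k x y
  star⇒walk ε = 0 , []
  star⇒walk (r ◅ rs) with k , w ← star⇒walk rs = suc k , r ∷ w

  reverse⁺ : ∀ {x y} → TransClosure (flip R) x y → TransClosure R y x
  reverse⁺ [ r ] = [ r ]
  reverse⁺ (r ∷ rs) = reverse⁺ rs ∷ʳ r

  unroll : ∀ {v} → TransClosure R v v → ∃[ f ] (∀ i → R (f i) (f (suc i)))
  unroll {v} cycle = proj₁ ∘ state , λ i → advance-step (state i)
    where
    Suffix : Set
    Suffix = ∃[ u ] TransClosure R u v

    advance : Suffix → Suffix
    advance (_ , [ _ ]) = v , cycle
    advance (_ , _ ∷ rs) = _ , rs

    advance-step : ∀ s → R (proj₁ s) (proj₁ (advance s))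
    advance-step (_ , [ r ]) = r
    advance-step (_ , r ∷ _) = r

    state : ℕ → Suffix
    state zero = v , cycle
    state (suc i) = advance (state i)

  segment : ∀ (f : ℕ → A) {a b} → (∀ i → i < b → R (f i) (f (suc i))) → a < b →
            TransClosure R (f a) (f b)
  segment f {a} {suc b} steps a<1+b with m<1+n⇒m<n∨m≡n a<1+b
  ... | inj₁ a<b = segment f (λ i i<b → steps i (m<n⇒m<1+n i<b)) a<b ∷ʳ steps b (n<1+n b)
  ... | inj₂ refl = [ steps a (n<1+n a) ]

module _ {n : ℕ} where

  walk⇒cycle : ∀ {R : Rel (Fin n) 0ℓ} (f : ℕ → Fin n) → (∀ i → i < n → R (f i) (f (suc i))) →
               ∃[ v ] TransClosure R v v
  walk⇒cycle {R} f steps with i , j , i<j , fi≡fj ← pigeonhole (n<1+n n) (f ∘ toℕ) =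
    f (toℕ i) , subst (TransClosure R _) (sym fi≡fj)
                  (segment f (λ t t<j → steps t (<-≤-trans t<j (s≤s⁻¹ (toℕ<n j)))) i<j)

  acyclic⇒no-long-walk : ∀ {R : Rel (Fin n) 0ℓ} → Acyclic R →
                         ∀ (f : ℕ → Fin n) → ¬ (∀ i → i < n → R (f i) (f (suc i)))
  acyclic⇒no-long-walk acyclic f steps with v , cycle ← walk⇒cycle f steps = acyclic v cycle

  acyclic⇒minimal : ∀ {P : Pred (Fin n) 0ℓ} {R : Rel (Fin n) 0ℓ} → Decidable₁ P → Decidable R →
                    (∀ {u v} → R u v → P u) → Acyclic R → ∃ P → ∃[ m ] P m × (∀ u → ¬ R u m)
  acyclic⇒minimal {P} {R} P? R? R⇒P acyclic start
    with any? (λ m → P? m ×-dec ¬? (any? (λ u → R? u m)))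
  ... | yes (m , Pm , no-pred) = m , Pm , λ u r → no-pred (u , r)
  ... | no no-minimal =
    ⊥-elim (acyclic⇒no-long-walk (λ v → acyclic v ∘ reverse⁺) (proj₁ ∘ descend) (λ i _ → descend-step i))
    where
    predecessor : ∀ m → P m → ∃[ u ] R u m
    predecessor m Pm with any? (λ u → R? u m)
    ... | yes pred = pred
    ... | no no-pred = ⊥-elim (no-minimal (m , Pm , no-pred))

    descend : ℕ → ∃ P
    descend zero = start
    descend (suc i) with u , r ← predecessor (proj₁ (descend i)) (proj₂ (descend i)) = u , R⇒P r

    descend-step : ∀ i → R (proj₁ (descend (suc i))) (proj₁ (descend i))
    descend-step i = proj₂ (predecessor (proj₁ (descend i)) (proj₂ (descend i)))

fold-within-period : ∀ {A : Set} (s : A → A) {w d} → 0 < d → fold w s d ≡ w →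
                ∀ r → ∃[ i ] i < d × fold w s r ≡ fold w s i
fold-within-period s 0<d period zero = 0 , 0<d , refl
fold-within-period s {w} {d} 0<d period (suc r) with i , i<d , eq ← fold-within-period s 0<d period r
  with m≤n⇒m<n∨m≡n i<d
... | inj₁ 1+i<d = suc i , 1+i<d , cong s eq
... | inj₂ 1+i≡d = 0 , 0<d , trans (cong s eq) (trans (cong (fold w s) 1+i≡d) period)

Between : ∀ {n} → Fin n → Fin n → Fin n → Set
Between i j k = (i Fin.< k × k Fin.< j) ⊎ (j Fin.< i × (i Fin.< k ⊎ k Fin.< j))

between-total : ∀ {n} {i a b : Fin n} → i ≢ a → i ≢ b → a ≢ b → Between i b a ⊎ Between i a b
between-total {i = i} {a} {b} i≢a i≢b a≢b with Finₚ.<-cmp i a | Finₚ.<-cmp a b | Finₚ.<-cmp i b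
... | tri≈ _ i≡a _ | _ | _ = ⊥-elim (i≢a i≡a)
... | _ | tri≈ _ a≡b _ | _ = ⊥-elim (a≢b a≡b)
... | _ | _ | tri≈ _ i≡b _ = ⊥-elim (i≢b i≡b)
... | tri< i<a _ _ | tri< a<b _ _ | _ = inj₁ (inj₁ (i<a , a<b))
... | tri< i<a _ _ | tri> _ _ b<a | tri< i<b _ _ = inj₂ (inj₁ (i<b , b<a))
... | tri< i<a _ _ | tri> _ _ b<a | tri> _ _ b<i = inj₁ (inj₂ (b<i , inj₁ i<a))
... | tri> _ _ a<i | tri< a<b _ _ | tri< i<b _ _ = inj₂ (inj₂ (a<i , inj₁ i<b))
... | tri> _ _ a<i | tri< a<b _ _ | tri> _ _ b<i = inj₁ (inj₂ (b<i , inj₂ a<b))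
... | tri> _ _ a<i | tri> _ _ b<a | _ = inj₂ (inj₂ (a<i , inj₂ b<a))

rank : ∀ {n} → Fin n → Fin n → ℕ
rank {n} i a with i Fin.<? a
... | yes _ = toℕ a
... | no _ = n + toℕ a

rank-after : ∀ {n} {i a : Fin n} → i Fin.< a → rank i a ≡ toℕ a
rank-after {i = i} {a} i<a with i Fin.<? a
... | yes _ = refl
... | no i≮a = ⊥-elim (i≮a i<a)

rank-before : ∀ {n} {i a : Fin n} → a Fin.< i → rank i a ≡ n + toℕ a
rank-before {i = i} {a} a<i with i Fin.<? a
... | yes i<a = ⊥-elim (<-asym a<i i<a)
... | no _ = refl

rank-increasing : ∀ {n} {i a b : Fin n} → a ≢ i → b ≢ i → a ≢ b → ¬ Between a b i → rank i a < rank i b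
rank-increasing {n} {i} {a} {b} a≢i b≢i a≢b i∉]a,b[ with Finₚ.<-cmp i a | Finₚ.<-cmp i b | Finₚ.<-cmp a b
... | tri≈ _ i≡a _ | _ | _ = ⊥-elim (a≢i (sym i≡a))
... | _ | tri≈ _ i≡b _ | _ = ⊥-elim (b≢i (sym i≡b))
... | _ | _ | tri≈ _ a≡b _ = ⊥-elim (a≢b a≡b)
... | tri< i<a _ _ | tri< i<b _ _ | tri< a<b _ _ rewrite rank-after i<a | rank-after i<b = a<b
... | tri< i<a _ _ | tri< i<b _ _ | tri> _ _ b<a = ⊥-elim (i∉]a,b[ (inj₂ (b<a , inj₂ i<b)))
... | tri< i<a _ _ | tri> _ _ b<i | _ rewrite rank-after i<a | rank-before b<i =
  <-≤-trans (toℕ<n a) (m≤m+n n (toℕ b))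
... | tri> _ _ a<i | tri< i<b _ _ | _ = ⊥-elim (i∉]a,b[ (inj₁ (a<i , i<b)))
... | tri> _ _ a<i | tri> _ _ b<i | tri< a<b _ _ rewrite rank-before a<i | rank-before b<i =
  +-monoʳ-< n a<b
... | tri> _ _ a<i | tri> _ _ b<i | tri> _ _ b<a = ⊥-elim (i∉]a,b[ (inj₂ (b<a , inj₁ a<i)))

condition2⇒condition1 : ∀ {n} (D : Digraph n) → IsOriented D → Condition2 D → Condition1 D
condition2⇒condition1 D (no-loop , asymmetric) (σ , interval) x = out-tournament , in-acyclic
  where
  open Inverse σ using (to)
  open Injection (↔⇒↣ σ) using () renaming (injective to to-injective)

  position-≢ : ∀ {u v} → Arc D u v → to u ≢ to v
  position-≢ {u} uv eq = no-loop u (subst (Arc D u) (sym (to-injective eq)) uv)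

  out-tournament : InducesTournament D (OutNbr D x)
  out-tournament u v xu xv u≢v
    with between-total (position-≢ xu) (position-≢ xv) (u≢v ∘ to-injective)
  ... | inj₁ u∈]x,v[ = inj₁ (interval x v u xv u∈]x,v[)
  ... | inj₂ v∈]x,u[ = inj₂ (interval x u v xu v∈]x,u[)

  rank-step : ∀ {u v} → InducedArc D (InNbr D x) u v → rank (to x) (to u) < rank (to x) (to v)
  rank-step {u} {v} (ux , vx , uv) =
    rank-increasing (position-≢ ux) (position-≢ vx) (position-≢ uv)
                    (λ x∈]u,v[ → asymmetric v x vx (interval u v x uv x∈]u,v[))

  rank-chain : ∀ {u v} → TransClosure (InducedArc D (InNbr D x)) u v → rank (to x) (to u) < rank (to x) (to v)
  rank-chain [ r ] = rank-step r
  rank-chain (r ∷ rs) = <-trans (rank-step r) (rank-chain rs)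

  in-acyclic : InducesAcyclic D (InNbr D x)
  in-acyclic v cycle = <-irrefl refl (rank-chain cycle)

Arc? : ∀ {n} (D : Digraph n) → Decidable (Arc D)
Arc? D u v = D u v Bool.≟ true

strongly-connected⇒out-arc : ∀ {m} {D : Digraph (suc (suc m))} → IsStronglyConnected D → ∀ x → ∃ (Arc D x)
strongly-connected⇒out-arc connected zero with connected zero (suc zero)
... | r ◅ _ = _ , r
strongly-connected⇒out-arc connected (suc x) with connected (suc x) zero
... | r ◅ _ = _ , r

module _ {n : ℕ} {D : Digraph n} where

  chain-first : ∀ {S u v} → TransClosure (InducedArc D S) u v → S u
  chain-first [ Su , _ ] = Su
  chain-first ((Su , _) ∷ _) = Su

  chain-last : ∀ {S u v} → TransClosure (InducedArc D S) u v → S v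
  chain-last [ _ , Sv , _ ] = Sv
  chain-last (_ ∷ rs) = chain-last rs

module _ {n : ℕ} (D : Digraph n) (no-loop : ∀ x → ¬ Arc D x x) (connected : IsStronglyConnected D)
         (condition1 : Condition1 D) (out-arc : ∀ x → ∃ (Arc D x)) where

  private
    V = Fin n

  out-tournament : ∀ x → InducesTournament D (OutNbr D x)
  out-tournament x = proj₁ (condition1 x)

  in-acyclic : ∀ y → InducesAcyclic D (InNbr D y)
  in-acyclic y = proj₂ (condition1 y)

  no-long-walk-into : ∀ y (f : ℕ → V) → (∀ i → i ≤ n → Arc D (f i) y) →
                      ¬ (∀ i → i < n → Arc D (f i) (f (suc i)))
  no-long-walk-into y f into steps =
    acyclic⇒no-long-walk (in-acyclic y) f (λ i i<n → into i (<⇒≤ i<n) , into (suc i) i<n , steps i i<n)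

  escape : ∀ {b c₀ c z l} → TransClosure (InducedArc D (InNbr D b)) c₀ c → Arc D z c₀ →
           Walk (Arc D) l c z → ∃[ l′ ] l′ ≤ l × Walk (Arc D) l′ b z
  escape chain zc₀ [] = ⊥-elim (in-acyclic _ _ (chain ∷ʳ (chain-last chain , chain-first chain , zc₀)))
  escape {b} {c = c} chain zc₀ (_∷_ {y = d} cd rest) with d Finₚ.≟ b
  ... | yes refl = _ , n≤1+n _ , rest
  ... | no d≢b with out-tournament c d b cd (chain-last chain) d≢b
  ...   | inj₂ bd = _ , ≤-refl , bd ∷ rest
  ...   | inj₁ db with l′ , l′≤l , walk ← escape (chain ∷ʳ (chain-last chain , db , cd)) zc₀ rest =
    l′ , m≤n⇒m≤1+n l′≤l , walk

  module _ (x : V) where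

    OutWalk : (ℕ → V) → Set
    OutWalk f = (∀ i → Arc D x (f i)) × (∀ i → Arc D (f i) (f (suc i)))

    out-walk-never-returns : ∀ k f → OutWalk f → ¬ Walk (Arc D) k (f 0) x
    out-walk-never-returns = <-rec _ step
      where
      step : ∀ k → (∀ {l} → l < k → ∀ f → OutWalk f → ¬ Walk (Arc D) l (f 0) x) →
             ∀ f → OutWalk f → ¬ Walk (Arc D) k (f 0) x
      step zero _ f (xf , _) [] = no-loop x (xf 0)
      step (suc k) shorter f (xf , ff) (_∷_ {y = p} f₀p rest) =
        no-long-walk-into p f (λ i _ → dominated i) (λ i _ → ff i)
        where
        unreachable : ∀ m {l} → l ≤ k → ¬ Walk (Arc D) l (f m) x
        unreachable m l≤k = shorter (s≤s l≤k) (λ t → f (t + m)) ((λ t → xf (t + m)) , (λ t → ff (t + m)))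

        dominated : ∀ i → Arc D (f i) p
        dominated zero = f₀p
        dominated (suc i) with f (suc i) Finₚ.≟ p
        ... | yes fᵢ₊₁≡p =
          ⊥-elim (unreachable (suc i) ≤-refl (subst (λ v → Walk (Arc D) k v x) (sym fᵢ₊₁≡p) rest))
        ... | no fᵢ₊₁≢p with out-tournament (f i) (f (suc i)) p (ff i) (dominated i) fᵢ₊₁≢p
        ...   | inj₁ fᵢ₊₁p = fᵢ₊₁p
        ...   | inj₂ pfᵢ₊₁ with _ , l≤k , walk ← escape [ ff i , pfᵢ₊₁ , dominated i ] (xf i) rest =
          ⊥-elim (unreachable (suc i) l≤k walk)

  out-acyclic : ∀ x → InducesAcyclic D (OutNbr D x)
  out-acyclic x v cycle with f , steps ← unroll cycle with k , walk ← star⇒walk (connected (f 0) x) =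
    out-walk-never-returns x k f ((λ i → proj₁ (steps i)) , (λ i → proj₂ (proj₂ (steps i)))) walk

  first-out : ∀ x → ∃[ s ] Arc D x s × (∀ y → Arc D x y → y ≢ s → Arc D s y)
  first-out x
    with s , xs , minimal ← acyclic⇒minimal (Arc? D x) (λ u v → Arc? D x u ×-dec Arc? D x v ×-dec Arc? D u v)
                                            proj₁ (out-acyclic x) (out-arc x)
    = s , xs , dominates
    where
    dominates : ∀ y → Arc D x y → y ≢ s → Arc D s y
    dominates y xy y≢s with out-tournament x s y xs xy (y≢s ∘ sym)
    ... | inj₁ sy = sy
    ... | inj₂ ys = ⊥-elim (minimal y (xy , xs , ys))

  next : V → V
  next x = proj₁ (first-out x)

  next-arc : ∀ x → Arc D x (next x)
  next-arc x = proj₁ (proj₂ (first-out x))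

  next-dominates : ∀ x y → Arc D x y → y ≢ next x → Arc D (next x) y
  next-dominates x = proj₂ (proj₂ (first-out x))

  chase : ∀ {u y} r → Arc D u y → (∀ p → p ≤ r → fold u next p ≢ y) → Arc D (fold u next r) y
  chase zero uy _ = uy
  chase (suc r) uy avoid =
    next-dominates _ _ (chase r uy (λ p p≤r → avoid p (m≤n⇒m≤1+n p≤r))) (avoid (suc r) ≤-refl ∘ sym)

  arc⇒on-orbit : ∀ {u t} → Arc D u t → ∃[ r ] fold u next r ≡ t
  arc⇒on-orbit {u} {t} ut with any? (λ (r : Fin (suc n)) → fold u next (toℕ r) Finₚ.≟ t)
  ... | yes (r , reached) = toℕ r , reached
  ... | no unreached =
    ⊥-elim (no-long-walk-into t (fold u next) (λ r r≤n → chase r ut (avoid r≤n)) (λ i _ → next-arc (fold u next i)))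
    where
    avoid : ∀ {r} → r ≤ n → ∀ p → p ≤ r → fold u next p ≢ t
    avoid r≤n p p≤r reached = unreached (fromℕ< (s≤s (≤-trans p≤r r≤n)) ,
      subst (λ q → fold u next q ≡ t) (sym (toℕ-fromℕ< (s≤s (≤-trans p≤r r≤n)))) reached)

  star⇒on-orbit : ∀ {u t} → Star (Arc D) u t → ∃[ r ] fold u next r ≡ t
  star⇒on-orbit ε = 0 , refl
  star⇒on-orbit (ut ◅ rest) with r₁ , e₁ ← arc⇒on-orbit ut with r₂ , e₂ ← star⇒on-orbit rest =
    r₂ + r₁ , trans (fold-+ _ next r₂) (trans (cong (λ w → fold w next r₂) e₁) e₂)

  orbit-covers : ∀ w {d} → 0 < d → fold w next d ≡ w → ∀ t → ∃[ i ] i < d × fold w next i ≡ t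
  orbit-covers w 0<d period t with r , reached ← star⇒on-orbit (connected w t)
    with i , i<d , same ← fold-within-period next 0<d period r = i , i<d , trans (sym same) reached

  n≤period : ∀ w {d} → 0 < d → fold w next d ≡ w → n ≤ d
  n≤period w {d} 0<d period = ≮⇒≥ short
    where
    index : ∀ t → ∃[ i ] fold w next (toℕ {d} i) ≡ t
    index t with i , i<d , reached ← orbit-covers w 0<d period t =
      fromℕ< i<d , trans (cong (fold w next) (toℕ-fromℕ< i<d)) reached

    short : ¬ d < n
    short d<n with t₁ , t₂ , t₁<t₂ , same-index ← pigeonhole d<n (proj₁ ∘ index) =
      <-irrefl (cong toℕ t₁≡t₂) t₁<t₂
      where
      t₁≡t₂ = trans (sym (proj₂ (index t₁))) (trans (cong (fold w next ∘ toℕ) same-index) (proj₂ (index t₂)))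

  module _ (v₀ : V) where

    orbit : ℕ → V
    orbit = fold v₀ next

    orbit-+ : ∀ a p → fold (orbit a) next p ≡ orbit (p + a)
    orbit-+ a p = sym (fold-+ v₀ next p)

    orbit-window : ∀ {a b} → a < b → orbit a ≡ orbit b → n + a ≤ b
    orbit-window {a} {b} a<b same = begin
      n + a       ≤⟨ +-monoˡ-≤ a (n≤period (orbit a) (m<n⇒0<n∸m a<b) returns) ⟩
      b ∸ a + a   ≡⟨ m∸n+n≡m (<⇒≤ a<b) ⟩
      b           ∎
      where
      open ≤-Reasoning
      returns : fold (orbit a) next (b ∸ a) ≡ orbit a
      returns = trans (orbit-+ a (b ∸ a)) (trans (cong orbit (m∸n+n≡m (<⇒≤ a<b))) (sym same))

    orbit-injective : ∀ {a b} → a < n → b < n → orbit a ≡ orbit b → a ≡ b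
    orbit-injective {a} {b} a<n b<n same with <-cmp a b
    ... | tri< a<b _ _ = ⊥-elim (<⇒≱ b<n (m+n≤o⇒m≤o n (orbit-window a<b same)))
    ... | tri≈ _ a≡b _ = a≡b
    ... | tri> _ _ b<a = ⊥-elim (<⇒≱ a<n (m+n≤o⇒m≤o n (orbit-window b<a (sym same))))

    orbit-period : orbit n ≡ v₀
    orbit-period with i , j , i<j , same ← pigeonhole (n<1+n n) (orbit ∘ toℕ) = begin
      orbit n          ≡⟨ cong orbit (sym j≡n) ⟩
      orbit (toℕ j)    ≡⟨ sym same ⟩
      orbit (toℕ i)    ≡⟨ cong orbit i≡0 ⟩
      v₀               ∎
      where
      open ≡-Reasoning
      window = orbit-window i<j same
      j≤n = s≤s⁻¹ (toℕ<n j)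
      j≡n = ≤-antisym j≤n (≤-trans (m≤m+n n (toℕ i)) window)
      i≡0 = n≤0⇒n≡0 (+-cancelˡ-≤ n (toℕ i) 0 (≤-trans window (subst (toℕ j ≤_) (sym (+-identityʳ n)) j≤n)))

    orbit-periodic : ∀ r → orbit (r + n) ≡ orbit r
    orbit-periodic r = trans (fold-+ v₀ next r) (cong (λ w → fold w next r) orbit-period)

    position : ∀ t → ∃[ k ] orbit (toℕ {n} k) ≡ t
    position t = fromℕ< i<n , trans (cong orbit (toℕ-fromℕ< i<n)) reached
      where
      covered = orbit-covers v₀ (<-≤-trans z<s (toℕ<n v₀)) orbit-period t
      i<n = proj₁ (proj₂ covered)
      reached = proj₂ (proj₂ covered)

    order : CyclicOrder n
    order = mk↔ₛ′ (proj₁ ∘ position) (orbit ∘ toℕ) position-orbit (proj₂ ∘ position)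
      where
      position-orbit : ∀ k → proj₁ (position (orbit (toℕ k))) ≡ k
      position-orbit k = toℕ-injective (orbit-injective (toℕ<n _) (toℕ<n k) (proj₂ (position (orbit (toℕ k)))))

    -- The positions of y and z, lifted into the window ]a, n + a[ after the position a of x.
    unwind : ∀ {i j k : Fin n} → Between i j k →
             ∃₂ λ b c → toℕ i < c × c < b × b < n + toℕ i × orbit b ≡ orbit (toℕ j) × orbit c ≡ orbit (toℕ k)
    unwind {i} {j} {k} (inj₁ (i<k , k<j)) =
      toℕ j , toℕ k , i<k , k<j , <-≤-trans (toℕ<n j) (m≤m+n n (toℕ i)) , refl , refl
    unwind {i} {j} {k} (inj₂ (j<i , inj₁ i<k)) =
      toℕ j + n , toℕ k , i<k , <-≤-trans (toℕ<n k) (m≤n+m n (toℕ j)) , j+n<n+i , orbit-periodic (toℕ j) , refl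
      where j+n<n+i = subst (_< n + toℕ i) (+-comm n (toℕ j)) (+-monoʳ-< n j<i)
    unwind {i} {j} {k} (inj₂ (j<i , inj₂ k<j)) =
      toℕ j + n , toℕ k + n , <-≤-trans (toℕ<n i) (m≤n+m n (toℕ k)) , +-monoˡ-< n k<j , j+n<n+i ,
      orbit-periodic (toℕ j) , orbit-periodic (toℕ k)
      where j+n<n+i = subst (_< n + toℕ i) (+-comm n (toℕ j)) (+-monoʳ-< n j<i)

    orbit-interval : ∀ {a b c} → a < c → c < b → b < n + a →
                     Arc D (orbit a) (orbit b) → Arc D (orbit c) (orbit b)
    orbit-interval {a} {b} {c} a<c c<b b<n+a ab =
      subst (λ v → Arc D v (orbit b)) (trans (orbit-+ a (c ∸ a)) (cong orbit (m∸n+n≡m (<⇒≤ a<c))))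
            (chase (c ∸ a) ab avoid)
      where
      avoid : ∀ p → p ≤ c ∸ a → fold (orbit a) next p ≢ orbit b
      avoid p p≤c∸a same = <-irrefl refl (begin-strict
        b            <⟨ b<n+a ⟩
        n + a        ≤⟨ +-monoʳ-≤ n (m≤n+m a p) ⟩
        n + (p + a)  ≤⟨ orbit-window p+a<b (trans (sym (orbit-+ a p)) same) ⟩
        b            ∎)
        where
        open ≤-Reasoning
        p+a<b : p + a < b
        p+a<b = ≤-<-trans (subst (p + a ≤_) (m∸n+n≡m (<⇒≤ a<c)) (+-monoˡ-≤ a p≤c∸a)) c<b

    condition2 : Condition2 D
    condition2 = order , arc-interval
      where
      arc-interval : ∀ x y z → Arc D x y → InOpenInterval order x y z → Arc D z y
      arc-interval x y z xy z∈]x,y[ =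
        let b , c , a<c , c<b , b<n+a , orbit-b , orbit-c = unwind z∈]x,y[
            at-y = trans orbit-b (proj₂ (position y))
        in subst₂ (Arc D) (trans orbit-c (proj₂ (position z))) at-y
             (orbit-interval a<c c<b b<n+a (subst₂ (Arc D) (sym (proj₂ (position x))) (sym at-y) xy))

theorem8p3p1 : ∀ (n : ℕ) (D : Digraph n) → IsOriented D → IsStronglyConnected D →
                 (Condition1 D → Condition2 D) × (Condition2 D → Condition1 D)
theorem8p3p1 zero D oriented _ = (λ _ → ↔-id _ , λ ()) , condition2⇒condition1 D oriented
theorem8p3p1 (suc zero) D oriented@(no-loop , _) _ =
  (λ _ → ↔-id _ , λ { zero zero _ loop _ → ⊥-elim (no-loop zero loop) }) , condition2⇒condition1 D oriented
theorem8p3p1 (suc (suc m)) D oriented connected =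
  (λ condition1 →
     condition2 D (proj₁ oriented) connected condition1 (strongly-connected⇒out-arc connected) zero) ,
  condition2⇒condition1 D oriented
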